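{- Let $G$ be a $P_6$-free graph and let $S\subseteq V(G)$ be a minimal separator in $G$, with $D_1,D_2$ two components of $G-S$ that are full to $S$, each having more than one vertex. For $i=1,2$, let $p_i,q_i\in V(D_i)$ be such that the modules of $\mathsf{Mod}(D_i)$ containing $p_i$ and $q_i$ are different but adjacent in $\mathsf{Quo}(D_i)$. Then: (1) if $\mathsf{Quo}(D_1)$ or $\mathsf{Quo}(D_2)$ is not a complete graph, then $S\subseteq N[p_1,q_1,p_2,q_2]$; (2) if both $\mathsf{Quo}(D_1)$ and $\mathsf{Quo}(D_2)$ are complete graphs, then there exist $r_1\in V(D_1)$ and $r_2\in V(D_2)$ such that $S\subseteq N[p_1,q_1,r_1,p_2,q_2,r_2]$.
   Context: Graphs are finite and simple; $P_6$-free means no induced path on $6$ vertices. $N[X]$ is the closed neighbourhood of a vertex set $X$ (union of closed neighbourhoods), and $N(X)=N[X]\setminus X$. A connected component $D$ of $G-S$ is full to $S$ if every vertex of $S$ has a neighbour in $D$. $S$ is a minimal separator if $G-S$ has at least two components full to $S$. A nonempty set $M$ is a module of a graph $H$ if every vertex outside $M$ is adjacent to all or none of $M$; it is strong if it does not overlap any other module (any other module is a subset, superset, or disjoint); for $|V(H)|\ge2$, the maximal strong modules different from $V(H)$ partition $V(H)$, forming $\mathsf{Mod}(H)$. The quotient graph $\mathsf{Quo}(H)$ has vertex set $\mathsf{Mod}(H)$ with two modules adjacent iff they are adjacent (completely joined) in $H$. -}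

module Defs where

open import Data.Nat using (ℕ; suc; _<_)
open import Data.Bool using (Bool; true; false; T)
open import Data.Fin using (Fin; toℕ)
open import Data.Fin.Subset using (Subset; _∈_; _∉_; _⊆_; ∣_∣; Nonempty)
open import Data.List using (List)
open import Data.Product using (Σ; ∃; ∃-syntax; _×_; _,_)
open import Data.Sum using (_⊎_)
open import Relation.Nullary using (¬_)
open import Relation.Binary.PropositionalEquality using (_≡_; _≢_)
open import Function.Definitions using (Injective)
open import Function.Bundles using (_⇔_)
import Data.List.Membership.Propositional as LM

record Graph : Set where
  field
    n     : ℕ
    adj   : Fin n → Fin n → Bool
    sym   : ∀ u v → adj u v ≡ adj v u
    irrefl : ∀ v → adj v v ≡ false

module _ (G : Graph) where
  open Graph G

  V : Set
  V = Fin n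

  Adj : V → V → Set
  Adj u v = T (adj u v)

  Consecutive : ∀ {k} → Fin k → Fin k → Set
  Consecutive i j = toℕ j ≡ suc (toℕ i) ⊎ toℕ i ≡ suc (toℕ j)

  HasInducedP6 : Set
  HasInducedP6 = Σ (Fin 6 → V) λ f →
    Injective _≡_ _≡_ f × (∀ i j → Adj (f i) (f j) ⇔ Consecutive i j)

  P6Free : Set
  P6Free = ¬ HasInducedP6

  data ReachIn (X : Subset n) : V → V → Set where
    here : ∀ {u} → u ∈ X → ReachIn X u u
    step : ∀ {u v w} → ReachIn X u v → Adj v w → w ∈ X → ReachIn X u w

  IsComponentOf : Subset n → Subset n → Set
  IsComponentOf S D =
    Nonempty D ×
    (∀ {v} → v ∈ D → v ∉ S) ×
    (∀ {u v} → u ∈ D → v ∈ D → ReachIn D u v) ×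
    (∀ {u v} → u ∈ D → v ∉ S → Adj u v → v ∈ D)

  FullTo : Subset n → Subset n → Set
  FullTo S D = ∀ {s} → s ∈ S → ∃[ d ] (d ∈ D × Adj s d)

  IsMinimalSeparator : Subset n → Set
  IsMinimalSeparator S = ∃[ C₁ ] ∃[ C₂ ]
    (C₁ ≢ C₂ × IsComponentOf S C₁ × IsComponentOf S C₂ × FullTo S C₁ × FullTo S C₂)

  IsModule : Subset n → Subset n → Set
  IsModule X M =
    Nonempty M × M ⊆ X ×
    (∀ {v} → v ∈ X → v ∉ M →
       (∀ {a} → a ∈ M → Adj v a) ⊎ (∀ {a} → a ∈ M → ¬ Adj v a))

  Overlap : Subset n → Subset n → Set
  Overlap M M' = (∃[ x ] (x ∈ M × x ∈ M')) × ¬ (M ⊆ M') × ¬ (M' ⊆ M)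

  IsStrongModule : Subset n → Subset n → Set
  IsStrongModule X M = IsModule X M × (∀ M' → IsModule X M' → ¬ Overlap M M')

  -- M ∈ Mod(G[X]): a maximal strong module of G[X] different from X
  InMod : Subset n → Subset n → Set
  InMod X M = IsStrongModule X M × M ≢ X ×
    (∀ M' → IsStrongModule X M' → M' ≢ X → M ⊆ M' → M' ≡ M)

  Joined : Subset n → Subset n → Set
  Joined A B = ∀ {a b} → a ∈ A → b ∈ B → Adj a b

  QuoComplete : Subset n → Set
  QuoComplete X = ∀ A B → InMod X A → InMod X B → A ≢ B → Joined A B

  CoveredBy : Subset n → List V → Set
  CoveredBy S xs = ∀ {s} → s ∈ S → ∃[ x ] (x LM.∈ xs × (s ≡ x ⊎ Adj s x))

module Submission where

-- Key fact (`Separator.noP4`): a vertex s ∈ S missing a vertex of Dⱼ starts no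
-- induced P4 s-a-b-c into Dᵢ, else an edge a′b′ of Dⱼ with s ~ a′, s ≁ b′
-- gives the induced P6 c-b-a-s-a′-b′.
-- (1) If s misses pᵢ, qᵢ and a vertex of Dⱼ, the component of pᵢ in
--     G[Dᵢ ∖ N(s)] is a proper module containing pᵢ, qᵢ (`commonModule`). A
--     non-complete Quo(G[Dᵢ]) makes G[Dᵢ] co-connected, and then every proper
--     module lies inside one member of Mod (`proper⊆Mod`): contradiction.
-- (2) With complete quotients, Dᵢ-neighbours of an s missing all anchors see
--     pᵢ (`complete-seesAnchor`), so the D₁-neighbourhoods of such s are nested
--     (`nested`); descending along them yields r₁, r₂ covering S.

open import Defs
open import Data.Nat using (ℕ; suc; _<_)
import Data.Nat as ℕ
open import Data.Nat.Properties using (<-irrefl)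
open import Data.Bool using (T; if_then_else_)
import Data.Bool as Bool
open import Data.Bool.Properties using (T-≡)
open import Data.Fin using (Fin; zero; suc; toℕ; _≟_)
open import Data.Fin.Properties using (any?; all?)
open import Data.Fin.Subset using (Subset; _∈_; _∉_; _⊆_; _⊂_; _∪_; _∩_; ⁅_⁆; ∣_∣)
open import Data.Fin.Subset.Properties
  using (_∈?_; _⊆?_; _⊂?_; nonempty?; anySubset?; Lift?; ⊆-refl; ⊆-antisym; x∈⁅x⁆; x∈⁅y⁆⇒x≡y; ∣⁅x⁆∣≡1;
         p⊆p∪q; q⊆p∪q; x∈p∪q⁺; x∈p∪q⁻; x∈p∩q⁺; x∈p∩q⁻)
open import Data.Fin.Subset.Induction using (⊂-wellFounded; ⊃-wellFounded)
open import Data.Vec using (tabulate)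
open import Data.Vec.Properties using (≡-dec; lookup∘tabulate; lookup⇒[]=; []=⇒lookup)
open import Data.List using ([]; _∷_)
open import Data.List.Relation.Unary.All using (All; []; _∷_)
import Data.List.Relation.Unary.All as All
import Data.List.Relation.Unary.Any as Any
open import Data.List.Relation.Unary.All.Properties using (¬Any⇒All¬)
import Data.List.Membership.Propositional as LM
open import Data.Product using (∃; ∃-syntax; _×_; _,_; proj₁; proj₂)
open import Data.Sum using (_⊎_; inj₁; inj₂; [_,_]′)
import Data.Sum as Sum
open import Data.Empty using (⊥; ⊥-elim)
open import Function using (_∘_; id)
open import Function.Bundles using (_⇔_; mk⇔; Equivalence)
open import Induction.WellFounded using (WellFounded; Acc; acc)
open import Level using (0ℓ)
open import Relation.Binary using (Rel; Symmetric; Decidable)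
open import Relation.Nullary using (¬_; Dec; yes; no; does)
open import Relation.Nullary.Decidable using (_×-dec_; _⊎-dec_; _→-dec_; ¬?; T?; decidable-stable; from-yes)
open import Relation.Binary.PropositionalEquality using (_≡_; _≢_; sym; trans; subst; cong)

search : {A B : Set} {_≺_ : Rel B 0ℓ} → WellFounded _≺_ → (μ : A → B) →
  {P : A → Set} {Q : Set} →
  (∀ x → P x → Q ⊎ ∃ λ y → P y × μ y ≺ μ x) → ∀ x → P x → Q
search {_≺_ = _≺_} wf μ {P} {Q} improve x px = go x px (wf (μ x))
  where
  go : ∀ x → P x → Acc _≺_ (μ x) → Q
  go x px (acc smaller) with improve x px
  ... | inj₁ q = q
  ... | inj₂ (y , py , y≺x) = go y py (smaller y≺x)

module _ {n : ℕ} where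

  _≟ₛ_ : (A B : Subset n) → Dec (A ≡ B)
  _≟ₛ_ = ≡-dec Bool._≟_

  grow : {P Q : Subset n → Set} →
    (∀ M → P M → Q M ⊎ ∃ λ M′ → P M′ × M ⊂ M′) → ∀ M → P M → ∃ λ M → P M × Q M
  grow improve = search ⊃-wellFounded id
    (λ M pM → Sum.map₁ (λ q → M , pM , q) (improve M pM))

  ⊈-witness : ∀ {A B : Subset n} → ¬ (A ⊆ B) → ∃ λ x → x ∈ A × x ∉ B
  ⊈-witness {A} {B} A⊈B with any? (λ x → (x ∈? A) ×-dec ¬? (x ∈? B))
  ... | yes witness = witness
  ... | no none = ⊥-elim (A⊈B (λ {x} x∈A → decidable-stable (x ∈? B) (λ x∉B → none (x , x∈A , x∉B))))

  allSubset? : {P : Subset n → Set} → (∀ M → Dec (P M)) → Dec (∀ M → P M)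
  allSubset? P? with anySubset? (¬? ∘ P?)
  ... | yes (M , ¬PM) = no (λ all → ¬PM (all M))
  ... | no none = yes (λ M → decidable-stable (P? M) (λ ¬PM → none (M , ¬PM)))

  data Walk (R : Rel (Fin n) 0ℓ) (X : Subset n) (a : Fin n) : Fin n → Set where
    start  : a ∈ X → Walk R X a a
    extend : ∀ {u v} → Walk R X a u → R u v → v ∈ X → Walk R X a v

  walk-end : ∀ {R X a b} → Walk R X a b → b ∈ X
  walk-end (start a∈X) = a∈X
  walk-end (extend _ _ b∈X) = b∈X

  walk-widen : ∀ {R X Y a b} → X ⊆ Y → Walk R X a b → Walk R Y a b
  walk-widen X⊆Y (start a∈X) = start (X⊆Y a∈X)
  walk-widen X⊆Y (extend w r v∈X) = extend (walk-widen X⊆Y w) r (X⊆Y v∈X)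

  Linked : Rel (Fin n) 0ℓ → Subset n → Fin n → Set
  Linked R X a = ∀ {d} → d ∈ X → Walk R X a d

  leave : ∀ {R X a b} {P : Fin n → Set} → (∀ x → Dec (P x)) → Walk R X a b → P a → ¬ P b →
    ∃[ u ] ∃[ v ] (P u × ¬ P v × R u v × u ∈ X × v ∈ X)
  leave P? (start _) Pa ¬Pb = ⊥-elim (¬Pb Pa)
  leave {b = b} P? (extend {u = u} w r b∈X) Pa ¬Pb with P? u
  ... | yes Pu = u , b , Pu , ¬Pb , r , walk-end w , b∈X
  ... | no ¬Pu = leave P? w Pa ¬Pu

  cut : ∀ {R X a} {P : Fin n → Set} → Symmetric R → Linked R X a → (∀ x → Dec (P x)) →
    ∀ {x y} → x ∈ X → P x → y ∈ X → ¬ P y →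
    ∃[ u ] ∃[ v ] (P u × ¬ P v × R u v × u ∈ X × v ∈ X)
  cut {a = a} R-sym linked P? x∈X Px y∈X ¬Py with P? a
  ... | yes Pa = leave P? (linked y∈X) Pa ¬Py
  ... | no ¬Pa with leave (¬? ∘ P?) (linked x∈X) ¬Pa (λ ¬Px → ¬Px Px)
  ...   | u , v , ¬Pu , ¬¬Pv , r , u∈X , v∈X =
          v , u , decidable-stable (P? v) ¬¬Pv , ¬Pu , R-sym r , v∈X , u∈X

  record Class (R : Rel (Fin n) 0ℓ) (X : Subset n) (a : Fin n) : Set where
    field
      members : Subset n
      root    : a ∈ members
      inside  : members ⊆ X
      linked  : Linked R members a
      closed  : ∀ {u v} → u ∈ members → v ∈ X → R u v → v ∈ members

  -- Reachability classes exist: start from {a} and add a missing R-successor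
  -- until the set is closed.
  reachClass : ∀ {R} → Decidable R → ∀ {X a} → a ∈ X → Class R X a
  reachClass {R} R? {X} {a} a∈X with grow improve ⁅ a ⁆ singleton
    where
    Candidate : Subset n → Set
    Candidate T = a ∈ T × T ⊆ X × Linked R T a
    Closed : Subset n → Set
    Closed T = ∀ {u v} → u ∈ T → v ∈ X → R u v → v ∈ T
    singleton : Candidate ⁅ a ⁆
    singleton = x∈⁅x⁆ a
              , (λ m → subst (_∈ X) (sym (x∈⁅y⁆⇒x≡y a m)) a∈X)
              , (λ m → subst (Walk R ⁅ a ⁆ a) (sym (x∈⁅y⁆⇒x≡y a m)) (start (x∈⁅x⁆ a)))
    improve : ∀ T → Candidate T → Closed T ⊎ ∃ λ T′ → Candidate T′ × T ⊂ T′
    improve T (a∈T , T⊆X , linked)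
      with any? (λ u → any? (λ v → (u ∈? T) ×-dec (v ∈? X) ×-dec R? u v ×-dec ¬? (v ∈? T)))
    ... | no none = inj₁ (λ {u} {v} u∈T v∈X r →
            decidable-stable (v ∈? T) (λ v∉T → none (u , v , u∈T , v∈X , r , v∉T)))
    ... | yes (u , v , u∈T , v∈X , r , v∉T) =
            inj₂ (T ∪ ⁅ v ⁆ , (p⊆p∪q _ a∈T , T′⊆X , linked′) , p⊆p∪q _ , v , v∈T′ , v∉T)
      where
      v∈T′ : v ∈ T ∪ ⁅ v ⁆
      v∈T′ = x∈p∪q⁺ (inj₂ (x∈⁅x⁆ v))
      T′⊆X : T ∪ ⁅ v ⁆ ⊆ X
      T′⊆X m with x∈p∪q⁻ T ⁅ v ⁆ m
      ... | inj₁ x∈T = T⊆X x∈T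
      ... | inj₂ x∈v = subst (_∈ X) (sym (x∈⁅y⁆⇒x≡y v x∈v)) v∈X
      linked′ : Linked R (T ∪ ⁅ v ⁆) a
      linked′ m with x∈p∪q⁻ T ⁅ v ⁆ m
      ... | inj₁ x∈T = walk-widen (p⊆p∪q _) (linked x∈T)
      ... | inj₂ x∈v = subst (Walk R (T ∪ ⁅ v ⁆) a) (sym (x∈⁅y⁆⇒x≡y v x∈v))
                         (extend (walk-widen (p⊆p∪q _) (linked u∈T)) r v∈T′)
  ... | T , (a∈T , T⊆X , linked) , closed = record
    { members = T ; root = a∈T ; inside = T⊆X ; linked = linked ; closed = closed }

pattern v₀ = zero
pattern v₁ = suc v₀
pattern v₂ = suc v₁
pattern v₃ = suc v₂
pattern v₄ = suc v₃
pattern v₅ = suc v₄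

module _ (G : Graph) where

  private
    N = Graph.n G

  Adj? : ∀ u v → Dec (Adj G u v)
  Adj? u v = T? (Graph.adj G u v)

  adj-sym : ∀ {u v} → Adj G u v → Adj G v u
  adj-sym {u} {v} = subst T (Graph.sym G u v)

  nonadj-sym : ∀ {u v} → ¬ Adj G u v → ¬ Adj G v u
  nonadj-sym ¬uv = ¬uv ∘ adj-sym

  adj-irrefl : ∀ {v} → ¬ Adj G v v
  adj-irrefl {v} = subst T (Graph.irrefl G v)

  Consecutive? : (i j : Fin 6) → Dec (Consecutive G i j)
  Consecutive? i j = (toℕ j ℕ.≟ suc (toℕ i)) ⊎-dec (toℕ i ℕ.≟ suc (toℕ j))

  distinguishable : ∀ i j → i ≡ j ⊎ ∃ λ k →
    (Consecutive G i k × ¬ Consecutive G j k) ⊎ (¬ Consecutive G i k × Consecutive G j k)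
  distinguishable = from-yes (all? λ i → all? λ j → (i ≟ j) ⊎-dec any? λ k →
    (Consecutive? i k ×-dec ¬? (Consecutive? j k)) ⊎-dec (¬? (Consecutive? i k) ×-dec Consecutive? j k))

  -- A sequence whose adjacencies are exactly the consecutive pairs is an
  -- induced P6; injectivity is automatic since positions are distinguishable.
  inducedPath : (f : Fin 6 → V G) → (∀ i j → Adj G (f i) (f j) ⇔ Consecutive G i j) → HasInducedP6 G
  inducedPath f pathPattern = f , injective , pathPattern
    where
    transport : ∀ {i j k} → f i ≡ f j → Consecutive G i k → Consecutive G j k
    transport {i} {j} {k} fi≡fj cik = Equivalence.to (pathPattern j k)
      (subst (λ w → Adj G w (f k)) fi≡fj (Equivalence.from (pathPattern i k) cik))
    injective : ∀ {i j} → f i ≡ f j → i ≡ j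
    injective {i} {j} fi≡fj with distinguishable i j
    ... | inj₁ i≡j = i≡j
    ... | inj₂ (k , inj₁ (cik , ¬cjk)) = ⊥-elim (¬cjk (transport fi≡fj cik))
    ... | inj₂ (k , inj₂ (¬cik , cjk)) = ⊥-elim (¬cik (transport (sym fi≡fj) cjk))

  mkP6 : ∀ {x₀ x₁ x₂ x₃ x₄ x₅} →
    Adj G x₀ x₁ → Adj G x₁ x₂ → Adj G x₂ x₃ → Adj G x₃ x₄ → Adj G x₄ x₅ →
    ¬ Adj G x₀ x₂ → ¬ Adj G x₀ x₃ → ¬ Adj G x₀ x₄ → ¬ Adj G x₀ x₅ →
    ¬ Adj G x₁ x₃ → ¬ Adj G x₁ x₄ → ¬ Adj G x₁ x₅ →
    ¬ Adj G x₂ x₄ → ¬ Adj G x₂ x₅ → ¬ Adj G x₃ x₅ → HasInducedP6 G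
  mkP6 {x₀} {x₁} {x₂} {x₃} {x₄} {x₅} a01 a12 a23 a34 a45 n02 n03 n04 n05 n13 n14 n15 n24 n25 n35 =
    inducedPath x (λ i j → fromTable (Consecutive? i j) (table i j))
    where
    x : Fin 6 → V G
    x v₀ = x₀
    x v₁ = x₁
    x v₂ = x₂
    x v₃ = x₃
    x v₄ = x₄
    x v₅ = x₅
    Expected : Fin 6 → Fin 6 → Set
    Expected i j = if does (Consecutive? i j) then Adj G (x i) (x j) else ¬ Adj G (x i) (x j)
    fromTable : ∀ {A C : Set} (C? : Dec C) → (if does C? then A else ¬ A) → A ⇔ C
    fromTable (yes c) a = mk⇔ (λ _ → c) (λ _ → a)
    fromTable (no ¬c) ¬a = mk⇔ (⊥-elim ∘ ¬a) (⊥-elim ∘ ¬c)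
    table : ∀ i j → Expected i j
    table v₀ v₀ = adj-irrefl
    table v₀ v₁ = a01
    table v₀ v₂ = n02
    table v₀ v₃ = n03
    table v₀ v₄ = n04
    table v₀ v₅ = n05
    table v₁ v₀ = adj-sym a01
    table v₁ v₁ = adj-irrefl
    table v₁ v₂ = a12
    table v₁ v₃ = n13
    table v₁ v₄ = n14
    table v₁ v₅ = n15
    table v₂ v₀ = nonadj-sym n02
    table v₂ v₁ = adj-sym a12
    table v₂ v₂ = adj-irrefl
    table v₂ v₃ = a23
    table v₂ v₄ = n24
    table v₂ v₅ = n25
    table v₃ v₀ = nonadj-sym n03
    table v₃ v₁ = nonadj-sym n13
    table v₃ v₂ = adj-sym a23
    table v₃ v₃ = adj-irrefl
    table v₃ v₄ = a34
    table v₃ v₅ = n35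
    table v₄ v₀ = nonadj-sym n04
    table v₄ v₁ = nonadj-sym n14
    table v₄ v₂ = nonadj-sym n24
    table v₄ v₃ = adj-sym a34
    table v₄ v₄ = adj-irrefl
    table v₄ v₅ = a45
    table v₅ v₀ = nonadj-sym n05
    table v₅ v₁ = nonadj-sym n15
    table v₅ v₂ = nonadj-sym n25
    table v₅ v₃ = nonadj-sym n35
    table v₅ v₄ = adj-sym a45
    table v₅ v₅ = adj-irrefl

  NonAdj : Rel (V G) 0ℓ
  NonAdj u v = ¬ Adj G u v

  Connected CoConnected : Subset N → Set
  Connected X = ∃ λ a → Linked (Adj G) X a
  CoConnected X = ∃ λ a → Linked NonAdj X a

  toWalk : ∀ {D u v} → ReachIn G D u v → Walk (Adj G) D u v
  toWalk (here u∈D) = start u∈D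
  toWalk (step r a v∈D) = extend (toWalk r) a v∈D

  component-walk : ∀ {S D u v} → IsComponentOf G S D → u ∈ D → v ∈ D → Walk (Adj G) D u v
  component-walk (_ , _ , reach , _) u∈D v∈D = toWalk (reach u∈D v∈D)

  component-connected : ∀ {S D} → IsComponentOf G S D → Connected D
  component-connected c@((a , a∈D) , _) = a , component-walk c a∈D

  components-apart : ∀ {S D₁ D₂} → D₁ ≢ D₂ → IsComponentOf G S D₁ → IsComponentOf G S D₂ →
    ∀ {u v} → u ∈ D₁ → v ∈ D₂ → ¬ Adj G u v
  components-apart {S} {D₁} {D₂} D₁≢D₂ c₁@(_ , D₁∌S , _) c₂@(_ , _ , _ , closed₂) {u} u∈D₁ v∈D₂ uv =
    D₁≢D₂ (⊆-antisym (absorbed c₁ c₂ u∈D₁ u∈D₂) (absorbed c₂ c₁ u∈D₂ u∈D₁))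
    where
    u∈D₂ : u ∈ D₂
    u∈D₂ = closed₂ v∈D₂ (D₁∌S u∈D₁) (adj-sym uv)
    absorbed : ∀ {E F x} → IsComponentOf G S E → IsComponentOf G S F → x ∈ E → x ∈ F → E ⊆ F
    absorbed {E} {F} {x} (_ , E∌S , reachE , _) (_ , _ , _ , closedF) x∈E x∈F y∈E = along (reachE x∈E y∈E)
      where
      along : ∀ {y} → ReachIn G E x y → y ∈ F
      along (here _) = x∈F
      along (step r a y∈E) = closedF (along r) (E∌S y∈E) a

  module _ (X : Subset N) where

    sees-all : ∀ {M v a b} → IsModule G X M → v ∈ X → v ∉ M → a ∈ M → b ∈ M → Adj G v a → Adj G v b
    sees-all (_ , _ , uniform) v∈X v∉M a∈M b∈M va with uniform v∈X v∉M
    ... | inj₁ all = all b∈M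
    ... | inj₂ none = ⊥-elim (none a∈M va)

    misses-all : ∀ {M v a b} → IsModule G X M → v ∈ X → v ∉ M → a ∈ M → b ∈ M → ¬ Adj G v a → ¬ Adj G v b
    misses-all mM v∈X v∉M a∈M b∈M ¬va vb = ¬va (sees-all mM v∈X v∉M b∈M a∈M vb)

    IsModule? : ∀ M → Dec (IsModule G X M)
    IsModule? M = nonempty? M ×-dec (M ⊆? X) ×-dec
      Lift? (λ v → ¬? (v ∈? M) →-dec (Lift? (Adj? v) M ⊎-dec Lift? (¬? ∘ Adj? v) M)) X

    Overlap? : ∀ M M′ → Dec (Overlap G M M′)
    Overlap? M M′ = any? (λ x → (x ∈? M) ×-dec (x ∈? M′)) ×-dec ¬? (M ⊆? M′) ×-dec ¬? (M′ ⊆? M)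

    IsStrongModule? : ∀ M → Dec (IsStrongModule G X M)
    IsStrongModule? M = IsModule? M ×-dec allSubset? (λ M′ → IsModule? M′ →-dec ¬? (Overlap? M M′))

    InMod? : ∀ M → Dec (InMod G X M)
    InMod? M = IsStrongModule? M ×-dec ¬? (M ≟ₛ X) ×-dec
      allSubset? (λ M′ → IsStrongModule? M′ →-dec ¬? (M′ ≟ₛ X) →-dec (M ⊆? M′) →-dec (M′ ≟ₛ M))

    comparable : ∀ {M M′ x} → IsStrongModule G X M → IsModule G X M′ → x ∈ M → x ∈ M′ → M ⊆ M′ ⊎ M′ ⊆ M
    comparable {M} {M′} {x} (_ , noOverlap) mM′ x∈M x∈M′ with M ⊆? M′ | M′ ⊆? M
    ... | yes M⊆M′ | _ = inj₁ M⊆M′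
    ... | no _ | yes M′⊆M = inj₂ M′⊆M
    ... | no M⊈M′ | no M′⊈M = ⊥-elim (noOverlap M′ mM′ ((x , x∈M , x∈M′) , M⊈M′ , M′⊈M))

    strong⊆Mod : ∀ {M A x} → IsStrongModule G X M → M ≢ X → InMod G X A → x ∈ A → x ∈ M → M ⊆ A
    strong⊆Mod {M} sM M≢X (sA , _ , maximal) x∈A x∈M with comparable sA (proj₁ sM) x∈A x∈M
    ... | inj₁ A⊆M = subst (M ⊆_) (maximal M sM M≢X A⊆M) ⊆-refl
    ... | inj₂ M⊆A = M⊆A

    Mod-unique : ∀ {A B x} → InMod G X A → InMod G X B → x ∈ A → x ∈ B → A ≡ B
    Mod-unique iA@(sA , A≢X , _) iB@(sB , B≢X , _) x∈A x∈B =
      ⊆-antisym (strong⊆Mod sA A≢X iB x∈B x∈A) (strong⊆Mod sB B≢X iA x∈A x∈B)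

    singleton-strong : ∀ {v} → v ∈ X → IsStrongModule G X ⁅ v ⁆
    singleton-strong {v} v∈X = ((v , x∈⁅x⁆ v) , ⁅v⁆⊆X , uniform) , noOverlap
      where
      ⁅v⁆⊆X : ⁅ v ⁆ ⊆ X
      ⁅v⁆⊆X m = subst (_∈ X) (sym (x∈⁅y⁆⇒x≡y v m)) v∈X
      uniform : ∀ {w} → w ∈ X → w ∉ ⁅ v ⁆ →
        (∀ {a} → a ∈ ⁅ v ⁆ → Adj G w a) ⊎ (∀ {a} → a ∈ ⁅ v ⁆ → ¬ Adj G w a)
      uniform {w} _ _ with Adj? w v
      ... | yes wv = inj₁ (λ m → subst (Adj G w) (sym (x∈⁅y⁆⇒x≡y v m)) wv)
      ... | no ¬wv = inj₂ (λ m → ¬wv ∘ subst (Adj G w) (x∈⁅y⁆⇒x≡y v m))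
      noOverlap : ∀ M′ → IsModule G X M′ → ¬ Overlap G ⁅ v ⁆ M′
      noOverlap M′ _ ((x , x∈⁅v⁆ , x∈M′) , ⁅v⁆⊈M′ , _) =
        ⁅v⁆⊈M′ (λ m → subst (_∈ M′) (trans (x∈⁅y⁆⇒x≡y v x∈⁅v⁆) (sym (x∈⁅y⁆⇒x≡y v m))) x∈M′)

    -- If |X| > 1, every vertex of X lies in a member of Mod(G[X]): grow its
    -- singleton through proper strong modules until it is maximal.
    Mod-cover : 1 < ∣ X ∣ → ∀ {v} → v ∈ X → ∃ λ A → InMod G X A × v ∈ A
    Mod-cover 1<∣X∣ {v} v∈X with grow improve ⁅ v ⁆ (singleton-strong v∈X , ⁅v⁆≢X , x∈⁅x⁆ v)
      where
      ⁅v⁆≢X : ⁅ v ⁆ ≢ X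
      ⁅v⁆≢X ⁅v⁆≡X = <-irrefl (trans (sym (∣⁅x⁆∣≡1 v)) (cong ∣_∣ ⁅v⁆≡X)) 1<∣X∣
      Candidate Maximal : Subset N → Set
      Candidate M = IsStrongModule G X M × M ≢ X × v ∈ M
      Maximal M = ∀ M′ → IsStrongModule G X M′ → M′ ≢ X → M ⊆ M′ → M′ ≡ M
      improve : ∀ M → Candidate M → Maximal M ⊎ ∃ λ M′ → Candidate M′ × M ⊂ M′
      improve M (_ , _ , v∈M) with anySubset? (λ M′ → IsStrongModule? M′ ×-dec ¬? (M′ ≟ₛ X) ×-dec (M ⊂? M′))
      ... | yes (M′ , sM′ , M′≢X , M⊂M′) = inj₂ (M′ , (sM′ , M′≢X , proj₁ M⊂M′ v∈M) , M⊂M′)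
      ... | no none = inj₁ maximal
        where
        maximal : Maximal M
        maximal M′ sM′ M′≢X M⊆M′ with M′ ≟ₛ M | M′ ⊆? M
        ... | yes M′≡M | _ = M′≡M
        ... | no M′≢M | yes M′⊆M = ⊥-elim (M′≢M (⊆-antisym M′⊆M M⊆M′))
        ... | no _ | no M′⊈M = ⊥-elim (none (M′ , sM′ , M′≢X , M⊆M′ , ⊈-witness M′⊈M))
    ... | A , (sA , A≢X , v∈A) , maximal = A , (sA , A≢X , maximal) , v∈A

    Mod⊆ : ∀ {A} → InMod G X A → A ⊆ X
    Mod⊆ (((_ , A⊆X , _) , _) , _) = A⊆X

    ∪-module : ∀ {M M′ x} → IsModule G X M → IsModule G X M′ → x ∈ M → x ∈ M′ → IsModule G X (M ∪ M′)
    ∪-module {M} {M′} {x} mM@(_ , M⊆X , _) mM′@(_ , M′⊆X , _) x∈M x∈M′ =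
      (x , p⊆p∪q M′ x∈M) , ∪⊆X , uniform
      where
      ∪⊆X : M ∪ M′ ⊆ X
      ∪⊆X m = [ M⊆X , M′⊆X ]′ (x∈p∪q⁻ M M′ m)
      uniform : ∀ {v} → v ∈ X → v ∉ M ∪ M′ →
        (∀ {a} → a ∈ M ∪ M′ → Adj G v a) ⊎ (∀ {a} → a ∈ M ∪ M′ → ¬ Adj G v a)
      uniform {v} v∈X v∉ with Adj? v x
      ... | yes vx = inj₁ (λ m → [ (λ a∈M → sees-all mM v∈X v∉M x∈M a∈M vx)
                                 , (λ a∈M′ → sees-all mM′ v∈X v∉M′ x∈M′ a∈M′ vx) ]′ (x∈p∪q⁻ M M′ m))
        where v∉M = v∉ ∘ p⊆p∪q M′ ; v∉M′ = v∉ ∘ q⊆p∪q M M′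
      ... | no ¬vx = inj₂ (λ m → [ (λ a∈M → misses-all mM v∈X v∉M x∈M a∈M ¬vx)
                                 , (λ a∈M′ → misses-all mM′ v∈X v∉M′ x∈M′ a∈M′ ¬vx) ]′ (x∈p∪q⁻ M M′ m))
        where v∉M = v∉ ∘ p⊆p∪q M′ ; v∉M′ = v∉ ∘ q⊆p∪q M M′

    -- A co-component of G[X] (a class of non-adjacency) is a strong module:
    -- every outside vertex is adjacent to all of it, and a module overlapping it
    -- would let the co-component grow.
    coComponent-strong : ∀ {a} (K : Class NonAdj X a) → IsStrongModule G X (Class.members K)
    coComponent-strong {a} K = ((a , root) , inside , uniform) , noOverlap
      where
      open Class K
      uniform : ∀ {v} → v ∈ X → v ∉ members →
        (∀ {k} → k ∈ members → Adj G v k) ⊎ (∀ {k} → k ∈ members → ¬ Adj G v k)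
      uniform {v} v∈X v∉K = inj₁ (λ {k} k∈K →
        decidable-stable (Adj? v k) (λ ¬vk → v∉K (closed k∈K v∈X (nonadj-sym ¬vk))))
      noOverlap : ∀ M → IsModule G X M → ¬ Overlap G members M
      noOverlap M mM@(_ , M⊆X , _) ((x , x∈K , x∈M) , K⊈M , M⊈K)
        with ⊈-witness K⊈M | ⊈-witness M⊈K
      ... | y , y∈K , y∉M | z , z∈M , z∉K
        with cut nonadj-sym linked (_∈? M) x∈K x∈M y∈K y∉M
      ... | u , v , u∈M , v∉M , ¬uv , _ , v∈K =
        z∉K (closed v∈K (M⊆X z∈M) (misses-all mM (inside v∈K) v∉M u∈M z∈M (nonadj-sym ¬uv)))

    unjoinedMods : ¬ QuoComplete G X → ∃[ A ] ∃[ B ]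
      (InMod G X A × InMod G X B × A ≢ B × ∃[ a ] ∃[ b ] (a ∈ A × b ∈ B × ¬ Adj G a b))
    unjoinedMods ¬complete with anySubset? (λ A → anySubset? λ B →
      InMod? A ×-dec InMod? B ×-dec ¬? (A ≟ₛ B) ×-dec
      any? λ a → any? λ b → (a ∈? A) ×-dec (b ∈? B) ×-dec ¬? (Adj? a b))
    ... | yes witness = witness
    ... | no none = ⊥-elim (¬complete λ A B iA iB A≢B {a} {b} a∈A b∈B →
      decidable-stable (Adj? a b) (λ ¬ab → none (A , B , iA , iB , A≢B , a , b , a∈A , b∈B , ¬ab)))

    -- If Quo(G[X]) is not complete then G[X] is co-connected: the co-component
    -- of a vertex a is a strong module reaching into a second member of Mod, so
    -- it cannot be proper.
    nonComplete⇒coConnected : ¬ QuoComplete G X → CoConnected X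
    nonComplete⇒coConnected ¬complete with unjoinedMods ¬complete
    ... | A , B , iA , iB , A≢B , a , b , a∈A , b∈B , ¬ab = a , linkedX
      where
      K : Class NonAdj X a
      K = reachClass (λ u v → ¬? (Adj? u v)) (Mod⊆ iA a∈A)
      open Class K
      K≡X : members ≡ X
      K≡X with members ≟ₛ X
      ... | yes K≡X = K≡X
      ... | no K≢X = ⊥-elim (A≢B (Mod-unique iA iB (K⊆A b∈K) b∈B))
        where
        K⊆A : members ⊆ A
        K⊆A = strong⊆Mod (coComponent-strong K) K≢X iA a∈A root
        b∈K : b ∈ members
        b∈K = closed root (Mod⊆ iB b∈B) ¬ab
      linkedX : Linked NonAdj X a
      linkedX d∈X = walk-widen inside (linked (subst (_ ∈_) (sym K≡X) d∈X))

    -- Two overlapping modules cannot cover a connected, co-connected G[X]: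
    -- the vertices outside M would be all adjacent or all non-adjacent to M.
    overlap-cover : Connected X → CoConnected X → ∀ {M M′} → IsModule G X M → IsModule G X M′ →
      Overlap G M M′ → (∀ {v} → v ∈ X → v ∈ M ⊎ v ∈ M′) → ⊥
    overlap-cover (_ , connected) (_ , coconnected) {M} {M′} mM@(_ , M⊆X , _) mM′@(_ , M′⊆X , _)
      ((w , w∈M , w∈M′) , M⊈M′ , M′⊈M) covers
      with ⊈-witness M⊈M′ | ⊈-witness M′⊈M
    ... | x , x∈M , x∉M′ | y , y∈M′ , y∉M = decide (Adj? y w)
      where
      x∈X : x ∈ X
      x∈X = M⊆X x∈M
      y∈X : y ∈ X
      y∈X = M′⊆X y∈M′
      in-M′ : ∀ {v} → v ∈ X → v ∉ M → v ∈ M′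
      in-M′ v∈X v∉M = [ ⊥-elim ∘ v∉M , id ]′ (covers v∈X)
      decide : Dec (Adj G y w) → ⊥
      decide (yes yw) with cut nonadj-sym coconnected (_∈? M) x∈X x∈M y∈X y∉M
      ... | u , v , u∈M , v∉M , ¬uv , _ , v∈X = ¬uv (adj-sym vu)
        where
        xy : Adj G x y
        xy = adj-sym (sees-all mM y∈X y∉M w∈M x∈M yw)
        xv : Adj G x v
        xv = sees-all mM′ x∈X x∉M′ y∈M′ (in-M′ v∈X v∉M) xy
        vu : Adj G v u
        vu = sees-all mM v∈X v∉M x∈M u∈M (adj-sym xv)
      decide (no ¬yw) with cut adj-sym connected (_∈? M) x∈X x∈M y∈X y∉M
      ... | u , v , u∈M , v∉M , uv , _ , v∈X = ¬vu (adj-sym uv)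
        where
        ¬xy : ¬ Adj G x y
        ¬xy = nonadj-sym (misses-all mM y∈X y∉M w∈M x∈M ¬yw)
        ¬xv : ¬ Adj G x v
        ¬xv = misses-all mM′ x∈X x∉M′ y∈M′ (in-M′ v∈X v∉M) ¬xy
        ¬vu : ¬ Adj G v u
        ¬vu = misses-all mM v∈X v∉M x∈M u∈M (nonadj-sym ¬xv)

    -- In a connected, co-connected G[X] every proper module extends to a proper
    -- strong module: keep absorbing overlapping modules.
    strongHull : Connected X → CoConnected X → ∀ {C} → IsModule G X C → C ≢ X →
      ∃ λ M → (IsStrongModule G X M × M ≢ X) × C ⊆ M
    strongHull conn coconn {C} mC C≢X with grow improve C (mC , C≢X , id)
      where
      Candidate Strong : Subset N → Set
      Candidate M = IsModule G X M × M ≢ X × C ⊆ M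
      Strong M = ∀ M′ → IsModule G X M′ → ¬ Overlap G M M′
      improve : ∀ M → Candidate M → Strong M ⊎ ∃ λ M′ → Candidate M′ × M ⊂ M′
      improve M (mM , M≢X , C⊆M) with anySubset? (λ M′ → IsModule? M′ ×-dec Overlap? M M′)
      ... | no none = inj₁ (λ M′ mM′ ov → none (M′ , mM′ , ov))
      ... | yes (M′ , mM′ , ov@((w , w∈M , w∈M′) , _ , M′⊈M)) =
        inj₂ (M ∪ M′ , (∪-module mM mM′ w∈M w∈M′ , ∪≢X , p⊆p∪q M′ ∘ C⊆M) , p⊆p∪q M′ , growth)
        where
        ∪≢X : M ∪ M′ ≢ X
        ∪≢X ∪≡X = overlap-cover conn coconn mM mM′ ov
          (λ {v} v∈X → x∈p∪q⁻ M M′ (subst (v ∈_) (sym ∪≡X) v∈X))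
        growth : ∃ λ z → z ∈ M ∪ M′ × z ∉ M
        growth with ⊈-witness M′⊈M
        ... | z , z∈M′ , z∉M = z , q⊆p∪q M M′ z∈M′ , z∉M
    ... | M , (mM , M≢X , C⊆M) , strong = M , ((mM , strong) , M≢X) , C⊆M

    proper⊆Mod : Connected X → CoConnected X → ∀ {C A x} → IsModule G X C → C ≢ X →
      InMod G X A → x ∈ A → x ∈ C → C ⊆ A
    proper⊆Mod conn coconn mC C≢X iA x∈A x∈C with strongHull conn coconn mC C≢X
    ... | M , (sM , M≢X) , C⊆M = strong⊆Mod sM M≢X iA x∈A (C⊆M x∈C) ∘ C⊆M

  cover-unless : ∀ {S xs} → (∀ {s} → s ∈ S → All (NonAdj s) xs → ⊥) → CoveredBy G S xs
  cover-unless {xs = xs} missing {s} s∈S with Any.any? (Adj? s) xs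
  ... | yes hit = let x , x∈xs , sx = LM.find hit in x , x∈xs , inj₂ sx
  ... | no none = ⊥-elim (missing s∈S (¬Any⇒All¬ xs none))

  nbhd : V G → Subset N
  nbhd s = tabulate (Graph.adj G s)

  ∈nbhd⁺ : ∀ {s x} → Adj G s x → x ∈ nbhd s
  ∈nbhd⁺ {s} {x} sx = lookup⇒[]= x _ (trans (lookup∘tabulate _ x) (Equivalence.to T-≡ sx))

  ∈nbhd⁻ : ∀ {s x} → x ∈ nbhd s → Adj G s x
  ∈nbhd⁻ {s} {x} x∈N = Equivalence.from T-≡ (trans (sym (lookup∘tabulate _ x)) ([]=⇒lookup x∈N))

module Separator (G : Graph) (noP6 : P6Free G) {S Dᵢ Dⱼ : Subset (Graph.n G)}
  (cᵢ : IsComponentOf G S Dᵢ) (cⱼ : IsComponentOf G S Dⱼ)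
  (fullᵢ : FullTo G S Dᵢ) (fullⱼ : FullTo G S Dⱼ)
  (apart : ∀ {u v} → u ∈ Dᵢ → v ∈ Dⱼ → ¬ Adj G u v) where

  -- A vertex s ∈ S missing some vertex t of Dⱼ starts no induced P4 s-a-b-c
  -- into Dᵢ: an edge of Dⱼ leaving N(s) would extend it to an induced P6.
  noP4 : ∀ {s t} → s ∈ S → t ∈ Dⱼ → ¬ Adj G s t → ∀ {a b c} → a ∈ Dᵢ → b ∈ Dᵢ → c ∈ Dᵢ →
    Adj G s a → Adj G a b → Adj G b c → ¬ Adj G s b → ¬ Adj G s c → ¬ Adj G a c → ⊥
  noP4 s∈S t∈Dⱼ ¬st a∈Dᵢ b∈Dᵢ c∈Dᵢ sa ab bc ¬sb ¬sc ¬ac with fullⱼ s∈S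
  ... | d , d∈Dⱼ , sd with leave (Adj? G _) (component-walk G cⱼ d∈Dⱼ t∈Dⱼ) sd ¬st
  ... | a′ , b′ , sa′ , ¬sb′ , a′b′ , a′∈Dⱼ , b′∈Dⱼ = noP6 (mkP6 G
    (adj-sym G bc) (adj-sym G ab) (adj-sym G sa) sa′ a′b′
    (nonadj-sym G ¬ac) (nonadj-sym G ¬sc) (apart c∈Dᵢ a′∈Dⱼ) (apart c∈Dᵢ b′∈Dⱼ)
    (nonadj-sym G ¬sb) (apart b∈Dᵢ a′∈Dⱼ) (apart b∈Dᵢ b′∈Dⱼ)
    (apart a∈Dᵢ a′∈Dⱼ) (apart a∈Dᵢ b′∈Dⱼ) ¬sb′)

  -- If s ∈ S misses a vertex of Dⱼ and two adjacent vertices p, q of Dᵢ, then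
  -- p and q lie in a common proper module of G[Dᵢ]: the component C of p in
  -- G[Dᵢ ∖ N(s)]. Every neighbour of s sees all of C or none of it, since
  -- otherwise s would start an induced P4 into Dᵢ.
  commonModule : ∀ {s t p q} → s ∈ S → t ∈ Dⱼ → ¬ Adj G s t →
    p ∈ Dᵢ → q ∈ Dᵢ → Adj G p q → ¬ Adj G s p → ¬ Adj G s q →
    ∃ λ C → IsModule G Dᵢ C × C ≢ Dᵢ × p ∈ C × q ∈ C
  commonModule {s} {t} {p} {q} s∈S t∈Dⱼ ¬st p∈Dᵢ q∈Dᵢ pq ¬sp ¬sq =
    members , ((p , root) , inside , uniform) , C≢Dᵢ , root , closed root q∈Dᵢ (pq , ¬sq)
    where
    Avoiding : V G → V G → Set
    Avoiding u v = Adj G u v × ¬ Adj G s v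
    C : Class Avoiding Dᵢ p
    C = reachClass (λ u v → Adj? G u v ×-dec ¬? (Adj? G s v)) p∈Dᵢ
    open Class C
    avoids : ∀ {v} → v ∈ members → ¬ Adj G s v
    avoids v∈C = along (linked v∈C)
      where
      along : ∀ {v} → Walk Avoiding members p v → ¬ Adj G s v
      along (start _) = ¬sp
      along (extend _ (_ , ¬sv) _) = ¬sv
    seesAll : ∀ {x v} → x ∈ Dᵢ → Adj G s x → Adj G x p → Walk Avoiding members p v → Adj G x v
    seesAll x∈Dᵢ sx xp (start _) = xp
    seesAll {x} {v} x∈Dᵢ sx xp (extend w (uv , ¬sv) v∈C) with Adj? G x v
    ... | yes xv = xv
    ... | no ¬xv = ⊥-elim (noP4 s∈S t∈Dⱼ ¬st x∈Dᵢ (inside (walk-end w)) (inside v∈C)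
                     sx (seesAll x∈Dᵢ sx xp w) uv (avoids (walk-end w)) ¬sv ¬xv)
    missesAll : ∀ {x v} → x ∈ Dᵢ → Adj G s x → ¬ Adj G x p → Walk Avoiding members p v → ¬ Adj G x v
    missesAll x∈Dᵢ sx ¬xp (start _) = ¬xp
    missesAll x∈Dᵢ sx ¬xp (extend w (uv , ¬sv) v∈C) xv =
      noP4 s∈S t∈Dⱼ ¬st x∈Dᵢ (inside v∈C) (inside (walk-end w)) sx xv (adj-sym G uv) ¬sv (avoids (walk-end w))
        (missesAll x∈Dᵢ sx ¬xp w)
    uniform : ∀ {v} → v ∈ Dᵢ → v ∉ members →
      (∀ {a} → a ∈ members → Adj G v a) ⊎ (∀ {a} → a ∈ members → ¬ Adj G v a)
    uniform {v} v∈Dᵢ v∉C with Adj? G s v | Adj? G v p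
    ... | no ¬sv | _ = inj₂ (λ a∈C va → v∉C (closed a∈C v∈Dᵢ (adj-sym G va , ¬sv)))
    ... | yes sv | yes vp = inj₁ (seesAll v∈Dᵢ sv vp ∘ linked)
    ... | yes sv | no ¬vp = inj₂ (missesAll v∈Dᵢ sv ¬vp ∘ linked)
    C≢Dᵢ : members ≢ Dᵢ
    C≢Dᵢ C≡Dᵢ with fullᵢ s∈S
    ... | d , d∈Dᵢ , sd = avoids (subst (d ∈_) (sym C≡Dᵢ) d∈Dᵢ) sd

  module Anchored {p q A B} (iA : InMod G Dᵢ A) (iB : InMod G Dᵢ B)
    (p∈A : p ∈ A) (q∈B : q ∈ B) (A≢B : A ≢ B) (joined : Joined G A B) where

    p∈Dᵢ : p ∈ Dᵢ
    p∈Dᵢ = Mod⊆ G Dᵢ iA p∈A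
    q∈Dᵢ : q ∈ Dᵢ
    q∈Dᵢ = Mod⊆ G Dᵢ iB q∈B

    -- If Quo(G[Dᵢ]) is not complete, no s ∈ S misses p, q and a vertex of
    -- Dⱼ: G[Dᵢ] is co-connected, so the common proper module of p and q would
    -- lie inside A, putting q into A.
    nonComplete-anchored : ¬ QuoComplete G Dᵢ → ∀ {s t} → s ∈ S → t ∈ Dⱼ → ¬ Adj G s t →
      ¬ Adj G s p → ¬ Adj G s q → ⊥
    nonComplete-anchored ¬complete s∈S t∈Dⱼ ¬st ¬sp ¬sq
      with commonModule s∈S t∈Dⱼ ¬st p∈Dᵢ q∈Dᵢ (joined p∈A q∈B) ¬sp ¬sq
    ... | C , mC , C≢Dᵢ , p∈C , q∈C = A≢B (Mod-unique G Dᵢ iA iB (C⊆A q∈C) q∈B)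
      where
      C⊆A : C ⊆ A
      C⊆A = proper⊆Mod G Dᵢ (component-connected G cᵢ) (nonComplete⇒coConnected G Dᵢ ¬complete)
              mC C≢Dᵢ iA p∈A p∈C

    -- If Quo(G[Dᵢ]) is complete and s ∈ S misses p, q and a vertex of Dⱼ,
    -- every neighbour x of s in Dᵢ is adjacent to p: x lies outside A (else
    -- s-x-q-p is an induced P4), and distinct members of Mod are joined.
    complete-seesAnchor : QuoComplete G Dᵢ → 1 < ∣ Dᵢ ∣ → ∀ {s t} → s ∈ S → t ∈ Dⱼ → ¬ Adj G s t →
      ¬ Adj G s p → ¬ Adj G s q → ∀ {x} → x ∈ Dᵢ → Adj G s x → Adj G x p
    complete-seesAnchor complete 1<∣Dᵢ∣ s∈S t∈Dⱼ ¬st ¬sp ¬sq {x} x∈Dᵢ sx with Adj? G x p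
    ... | yes xp = xp
    ... | no ¬xp with Mod-cover G Dᵢ 1<∣Dᵢ∣ x∈Dᵢ
    ...   | X , iX , x∈X with X ≟ₛ A
    ...     | no X≢A = complete X A iX iA X≢A x∈X p∈A
    ...     | yes X≡A = ⊥-elim (noP4 s∈S t∈Dⱼ ¬st x∈Dᵢ q∈Dᵢ p∈Dᵢ sx xq (adj-sym G (joined p∈A q∈B)) ¬sq ¬sp ¬xp)
      where
      xq : Adj G x q
      xq = joined (subst (x ∈_) X≡A x∈X) q∈B

module TwoSides (G : Graph) (noP6 : P6Free G) {S D₁ D₂ : Subset (Graph.n G)} (D₁≢D₂ : D₁ ≢ D₂)
  (c₁ : IsComponentOf G S D₁) (c₂ : IsComponentOf G S D₂) (full₁ : FullTo G S D₁) (full₂ : FullTo G S D₂)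
  {p₁ q₁ A₁ B₁} (iA₁ : InMod G D₁ A₁) (iB₁ : InMod G D₁ B₁) (p₁∈A₁ : p₁ ∈ A₁) (q₁∈B₁ : q₁ ∈ B₁)
  (A₁≢B₁ : A₁ ≢ B₁) (joined₁ : Joined G A₁ B₁)
  {p₂ q₂ A₂ B₂} (iA₂ : InMod G D₂ A₂) (iB₂ : InMod G D₂ B₂) (p₂∈A₂ : p₂ ∈ A₂) (q₂∈B₂ : q₂ ∈ B₂)
  (A₂≢B₂ : A₂ ≢ B₂) (joined₂ : Joined G A₂ B₂) where

  apart₁₂ : ∀ {u v} → u ∈ D₁ → v ∈ D₂ → ¬ Adj G u v
  apart₁₂ = components-apart G D₁≢D₂ c₁ c₂

  apart₂₁ : ∀ {u v} → u ∈ D₂ → v ∈ D₁ → ¬ Adj G u v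
  apart₂₁ = components-apart G (D₁≢D₂ ∘ sym) c₂ c₁

  module Anchor₁ = Separator.Anchored G noP6 c₁ c₂ full₁ full₂ apart₁₂ iA₁ iB₁ p₁∈A₁ q₁∈B₁ A₁≢B₁ joined₁
  module Anchor₂ = Separator.Anchored G noP6 c₂ c₁ full₂ full₁ apart₂₁ iA₂ iB₂ p₂∈A₂ q₂∈B₂ A₂≢B₂ joined₂
  p₁∈D₁ : p₁ ∈ D₁
  p₁∈D₁ = Anchor₁.p∈Dᵢ
  p₂∈D₂ : p₂ ∈ D₂
  p₂∈D₂ = Anchor₂.p∈Dᵢ

  nonCompleteCase : ¬ QuoComplete G D₁ ⊎ ¬ QuoComplete G D₂ → CoveredBy G S (p₁ ∷ q₁ ∷ p₂ ∷ q₂ ∷ [])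
  nonCompleteCase ¬complete = cover-unless G λ where
    s∈S (¬sp₁ ∷ ¬sq₁ ∷ ¬sp₂ ∷ ¬sq₂ ∷ []) →
      [ (λ ¬c₁ → Anchor₁.nonComplete-anchored ¬c₁ s∈S p₂∈D₂ ¬sp₂ ¬sp₁ ¬sq₁)
      , (λ ¬c₂ → Anchor₂.nonComplete-anchored ¬c₂ s∈S p₁∈D₁ ¬sp₁ ¬sp₂ ¬sq₂) ]′ ¬complete

  module Complete (complete₁ : QuoComplete G D₁) (complete₂ : QuoComplete G D₂)
    (1<∣D₁∣ : 1 < ∣ D₁ ∣) (1<∣D₂∣ : 1 < ∣ D₂ ∣) where

    Unanchored : V G → Set
    Unanchored s = All (NonAdj G s) (p₁ ∷ q₁ ∷ p₂ ∷ q₂ ∷ [])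

    sees₁ : ∀ {s x} → s ∈ S → Unanchored s → x ∈ D₁ → Adj G s x → Adj G x p₁
    sees₁ s∈S (¬sp₁ ∷ ¬sq₁ ∷ ¬sp₂ ∷ _ ∷ []) =
      Anchor₁.complete-seesAnchor complete₁ 1<∣D₁∣ s∈S p₂∈D₂ ¬sp₂ ¬sp₁ ¬sq₁

    sees₂ : ∀ {s x} → s ∈ S → Unanchored s → x ∈ D₂ → Adj G s x → Adj G x p₂
    sees₂ s∈S (¬sp₁ ∷ _ ∷ ¬sp₂ ∷ ¬sq₂ ∷ []) =
      Anchor₂.complete-seesAnchor complete₂ 1<∣D₂∣ s∈S p₁∈D₁ ¬sp₁ ¬sp₂ ¬sq₂

    nested : ∀ {s s′ x₁ x₂ x′} → s ∈ S → s′ ∈ S → Unanchored s → Unanchored s′ →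
      x₁ ∈ D₁ → Adj G s x₁ → ¬ Adj G s′ x₁ → x₂ ∈ D₂ → Adj G s x₂ → ¬ Adj G s′ x₂ →
      x′ ∈ D₁ → Adj G s′ x′ → Adj G s x′
    nested {s} {s′} {x₁} {x₂} {x′} s∈S s′∈S u@(¬sp₁ ∷ _ ∷ ¬sp₂ ∷ _ ∷ []) u′@(¬s′p₁ ∷ _ ∷ ¬s′p₂ ∷ _ ∷ [])
      x₁∈D₁ sx₁ ¬s′x₁ x₂∈D₂ sx₂ ¬s′x₂ x′∈D₁ s′x′ =
      decidable-stable (Adj? G s x′) (λ ¬sx′ → noP6 (inducedP6 ¬sx′ (Adj? G s s′) (Adj? G x₁ x′)))
      where
      x₁p₁ : Adj G x₁ p₁
      x₁p₁ = sees₁ s∈S u x₁∈D₁ sx₁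
      x′p₁ : Adj G x′ p₁
      x′p₁ = sees₁ s′∈S u′ x′∈D₁ s′x′
      x₂p₂ : Adj G x₂ p₂
      x₂p₂ = sees₂ s∈S u x₂∈D₂ sx₂
      inducedP6 : ¬ Adj G s x′ → Dec (Adj G s s′) → Dec (Adj G x₁ x′) → HasInducedP6 G
      -- p₁ - x′ - s′ - s - x₂ - p₂
      inducedP6 ¬sx′ (yes ss′) _ = mkP6 G
        (adj-sym G x′p₁) (adj-sym G s′x′) (adj-sym G ss′) sx₂ x₂p₂
        (nonadj-sym G ¬s′p₁) (nonadj-sym G ¬sp₁) (apart₁₂ p₁∈D₁ x₂∈D₂) (apart₁₂ p₁∈D₁ p₂∈D₂)
        (nonadj-sym G ¬sx′) (apart₁₂ x′∈D₁ x₂∈D₂) (apart₁₂ x′∈D₁ p₂∈D₂)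
        ¬s′x₂ ¬s′p₂ ¬sp₂
      -- p₂ - x₂ - s - x₁ - x′ - s′
      inducedP6 ¬sx′ (no ¬ss′) (yes x₁x′) = mkP6 G
        (adj-sym G x₂p₂) (adj-sym G sx₂) sx₁ x₁x′ (adj-sym G s′x′)
        (nonadj-sym G ¬sp₂) (apart₂₁ p₂∈D₂ x₁∈D₁) (apart₂₁ p₂∈D₂ x′∈D₁) (nonadj-sym G ¬s′p₂)
        (apart₂₁ x₂∈D₂ x₁∈D₁) (apart₂₁ x₂∈D₂ x′∈D₁) (nonadj-sym G ¬s′x₂)
        ¬sx′ ¬ss′ (nonadj-sym G ¬s′x₁)
      -- x₂ - s - x₁ - p₁ - x′ - s′
      inducedP6 ¬sx′ (no ¬ss′) (no ¬x₁x′) = mkP6 G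
        (adj-sym G sx₂) sx₁ x₁p₁ (adj-sym G x′p₁) (adj-sym G s′x′)
        (apart₂₁ x₂∈D₂ x₁∈D₁) (apart₂₁ x₂∈D₂ p₁∈D₁) (apart₂₁ x₂∈D₂ x′∈D₁) (nonadj-sym G ¬s′x₂)
        ¬sp₁ ¬sx′ ¬ss′
        ¬x₁x′ (nonadj-sym G ¬s′x₁) (nonadj-sym G ¬s′p₁)

    trace : V G → Subset (Graph.n G)
    trace s = D₁ ∩ nbhd G s

    Result : Set
    Result = ∃[ r₁ ] ∃[ r₂ ] (r₁ ∈ D₁ × r₂ ∈ D₂ × CoveredBy G S (p₁ ∷ q₁ ∷ r₁ ∷ p₂ ∷ q₂ ∷ r₂ ∷ []))

    -- For an unanchored s ∈ S pick neighbours x₁ ∈ D₁, x₂ ∈ D₂. Either they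
    -- complete the cover, or an s′ ∈ S missing them is unanchored and, by
    -- `nested`, has a strictly smaller trace.
    improve : ∀ s → s ∈ S × Unanchored s → Result ⊎ ∃ λ s′ → (s′ ∈ S × Unanchored s′) × trace s′ ⊂ trace s
    improve s (s∈S , u) with full₁ s∈S | full₂ s∈S
    ... | x₁ , x₁∈D₁ , sx₁ | x₂ , x₂∈D₂ , sx₂
      with any? (λ s′ → (s′ ∈? S) ×-dec All.all? (¬? ∘ Adj? G s′) (p₁ ∷ q₁ ∷ x₁ ∷ p₂ ∷ q₂ ∷ x₂ ∷ []))
    ... | no none = inj₁ (x₁ , x₂ , x₁∈D₁ , x₂∈D₂ , cover-unless G (λ s′∈S miss → none (_ , s′∈S , miss)))
    ... | yes (s′ , s′∈S , ¬s′p₁ ∷ ¬s′q₁ ∷ ¬s′x₁ ∷ ¬s′p₂ ∷ ¬s′q₂ ∷ ¬s′x₂ ∷ []) =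
      inj₂ (s′ , (s′∈S , u′) , shrinks , x₁ , x∈p∩q⁺ (x₁∈D₁ , ∈nbhd⁺ G sx₁) , ¬s′x₁ ∘ ∈nbhd⁻ G ∘ proj₂ ∘ x∈p∩q⁻ D₁ _)
      where
      u′ : Unanchored s′
      u′ = ¬s′p₁ ∷ ¬s′q₁ ∷ ¬s′p₂ ∷ ¬s′q₂ ∷ []
      shrinks : trace s′ ⊆ trace s
      shrinks m with x∈p∩q⁻ D₁ _ m
      ... | x′∈D₁ , x′∈N = x∈p∩q⁺ (x′∈D₁ , ∈nbhd⁺ G
              (nested s∈S s′∈S u u′ x₁∈D₁ sx₁ ¬s′x₁ x₂∈D₂ sx₂ ¬s′x₂ x′∈D₁ (∈nbhd⁻ G x′∈N)))

    -- If no s ∈ S is unanchored, r₁ = p₁ and r₂ = p₂ do; otherwise descend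
    -- along traces from an unanchored vertex.
    completeCase : Result
    completeCase with any? (λ s → (s ∈? S) ×-dec All.all? (¬? ∘ Adj? G s) (p₁ ∷ q₁ ∷ p₂ ∷ q₂ ∷ []))
    ... | yes (s , s∈S , u) = search ⊂-wellFounded trace improve s (s∈S , u)
    ... | no none = p₁ , p₂ , p₁∈D₁ , p₂∈D₂ , cover-unless G λ where
      s∈S (¬sp₁ ∷ ¬sq₁ ∷ _ ∷ ¬sp₂ ∷ ¬sq₂ ∷ _ ∷ []) → none (_ , s∈S , ¬sp₁ ∷ ¬sq₁ ∷ ¬sp₂ ∷ ¬sq₂ ∷ [])

lemma3p4 : (G : Graph) → P6Free G →
    (S D₁ D₂ : Subset (Graph.n G)) →
    IsMinimalSeparator G S →
    D₁ ≢ D₂ →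
    IsComponentOf G S D₁ → IsComponentOf G S D₂ →
    FullTo G S D₁ → FullTo G S D₂ →
    1 < ∣ D₁ ∣ → 1 < ∣ D₂ ∣ →
    (p₁ q₁ p₂ q₂ : V G) →
    p₁ ∈ D₁ → q₁ ∈ D₁ → p₂ ∈ D₂ → q₂ ∈ D₂ →
    (A₁ B₁ A₂ B₂ : Subset (Graph.n G)) →
    InMod G D₁ A₁ → InMod G D₁ B₁ → p₁ ∈ A₁ → q₁ ∈ B₁ → A₁ ≢ B₁ → Joined G A₁ B₁ →
    InMod G D₂ A₂ → InMod G D₂ B₂ → p₂ ∈ A₂ → q₂ ∈ B₂ → A₂ ≢ B₂ → Joined G A₂ B₂ →
    ((¬ QuoComplete G D₁ ⊎ ¬ QuoComplete G D₂) →
       CoveredBy G S (p₁ ∷ q₁ ∷ p₂ ∷ q₂ ∷ []))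
    ×
    (QuoComplete G D₁ → QuoComplete G D₂ →
       ∃[ r₁ ] ∃[ r₂ ] (r₁ ∈ D₁ × r₂ ∈ D₂ ×
         CoveredBy G S (p₁ ∷ q₁ ∷ r₁ ∷ p₂ ∷ q₂ ∷ r₂ ∷ [])))
lemma3p4 G noP6 S D₁ D₂ _ D₁≢D₂ c₁ c₂ full₁ full₂ 1<∣D₁∣ 1<∣D₂∣ p₁ q₁ p₂ q₂ _ _ _ _ A₁ B₁ A₂ B₂
  iA₁ iB₁ p₁∈A₁ q₁∈B₁ A₁≢B₁ joined₁ iA₂ iB₂ p₂∈A₂ q₂∈B₂ A₂≢B₂ joined₂ =
  nonCompleteCase , λ complete₁ complete₂ → Complete.completeCase complete₁ complete₂ 1<∣D₁∣ 1<∣D₂∣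
  where
  open TwoSides G noP6 D₁≢D₂ c₁ c₂ full₁ full₂
    iA₁ iB₁ p₁∈A₁ q₁∈B₁ A₁≢B₁ joined₁ iA₂ iB₂ p₂∈A₂ q₂∈B₂ A₂≢B₂ joined₂
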